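{- Let $G$ be a connected cactus graph. Then every very strong rainbow coloring of $G$ assigns pairwise distinct colors to the bridges of $G$ (edges not contained in any cycle).
   Context: All graphs are finite, simple and undirected. A cactus graph is a graph in which every edge belongs to at most one cycle. A very strong rainbow coloring of $G$ is a coloring of $E(G)$ such that for every pair of vertices and every shortest path between them, all edges of that path receive pairwise different colors. -}

module Defs where

open import Data.Nat using (ℕ; zero; suc; _≤_)
open import Data.Fin using (Fin)
open import Data.List using (List; []; _∷_; map; length)
open import Data.List.Membership.Propositional using (_∈_)
open import Data.List.Relation.Unary.Unique.Propositional using (Unique)
open import Data.Product using (_×_; _,_; ∃; ∃-syntax)
open import Data.Sum using (_⊎_)
open import Data.Empty using (⊥)
open import Relation.Nullary using (¬_)
open import Relation.Binary.PropositionalEquality using (_≡_)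
open import Function.Bundles using (_⇔_)

record Graph : Set₁ where
  field
    n       : ℕ
    Adj     : Fin n → Fin n → Set
    sym     : ∀ {u v} → Adj u v → Adj v u
    irrefl  : ∀ {u} → ¬ Adj u u

module _ (G : Graph) where
  open Graph G

  data Walk : Fin n → Fin n → Set where
    []  : ∀ {u} → Walk u u
    _∷_ : ∀ {u w v} → Adj u w → Walk w v → Walk u v

  len : ∀ {u v} → Walk u v → ℕ
  len []       = 0
  len (_ ∷ p)  = suc (len p)

  verts : ∀ {u v} → Walk u v → List (Fin n)
  verts {u} []      = u ∷ []
  verts {u} (_ ∷ p) = u ∷ verts p

  tailVerts : ∀ {u v} → Walk u v → List (Fin n)
  tailVerts []      = []
  tailVerts (_ ∷ p) = verts p

  edges : ∀ {u v} → Walk u v → List (Fin n × Fin n)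
  edges []                = []
  edges {u} (_∷_ {w = w} _ p) = (u , w) ∷ edges p

  IsPath : ∀ {u v} → Walk u v → Set
  IsPath p = Unique (verts p)

  IsShortestPath : ∀ {u v} → Walk u v → Set
  IsShortestPath {u} {v} p = IsPath p × (∀ (q : Walk u v) → IsPath q → len p ≤ len q)

  Connected : Set
  Connected = ∀ (u v : Fin n) → ∃[ p ] IsPath {u} {v} p

  IsCycle : ∀ {u} → Walk u u → Set
  IsCycle p = 3 ≤ len p × Unique (tailVerts p)

  EdgeOf : ∀ {u v} → Walk u v → Fin n → Fin n → Set
  EdgeOf p a b = ((a , b) ∈ edges p) ⊎ ((b , a) ∈ edges p)

  -- two cycles are the same subgraph iff they have the same edge set
  SameEdgeSet : ∀ {u v x y} → Walk u v → Walk x y → Set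
  SameEdgeSet p q = ∀ a b → EdgeOf p a b ⇔ EdgeOf q a b

  IsCactus : Set
  IsCactus = ∀ {a b} → Adj a b →
             ∀ {u} (C₁ : Walk u u) {w} (C₂ : Walk w w) →
             IsCycle C₁ → IsCycle C₂ → EdgeOf C₁ a b → EdgeOf C₂ a b →
             SameEdgeSet C₁ C₂

  IsBridge : Fin n → Fin n → Set
  IsBridge a b = Adj a b × (∀ {u} (C : Walk u u) → IsCycle C → ¬ EdgeOf C a b)

  record EdgeColouring (C : Set) : Set where
    field
      -- only the values on adjacent pairs are relevant
      col     : Fin n → Fin n → C
      col-sym : ∀ a b → col a b ≡ col b a

  colours : ∀ {C : Set} → EdgeColouring C → ∀ {u v} → Walk u v → List C
  colours c []      = []
  colours c {u} (_∷_ {w = w} _ p) = EdgeColouring.col c u w ∷ colours c p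

  IsVSRC : ∀ {C : Set} → EdgeColouring C → Set
  IsVSRC c = ∀ {u v} (p : Walk u v) → IsShortestPath p → Unique (colours c p)

  SameEdge : Fin n → Fin n → Fin n → Fin n → Set
  SameEdge a b x y = (a ≡ x × b ≡ y) ⊎ (a ≡ y × b ≡ x)

-- Let e = {a,b} and f = {x,y} be distinct bridges of the same colour. If two
-- vertices s, t could be joined neither by a walk avoiding e nor by one avoiding
-- f, then every shortest s–t path would traverse both e and f and so would not
-- be rainbow. Hence the two equivalence relations "joined by a walk avoiding e"
-- and "joined by a walk avoiding f" together cover all pairs of vertices, which
-- forces one of them to be total. But the end points of a bridge are never
-- joined by a walk avoiding it, since such a walk would close a cycle through
-- the bridge.
module Submission where

open import Defs
open import Data.Nat using (ℕ; s≤s; z≤n)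
open import Data.Nat.Properties using (≮⇒≥)
open import Data.Nat.Induction using (<-rec)
open import Data.Fin using (Fin; _≟_)
open import Data.List.Relation.Unary.Any using (here; there; any?)
open import Data.List.Relation.Unary.All using ([]; _∷_)
open import Data.List.Relation.Unary.All.Properties.Core using (¬Any⇒All¬; All¬⇒¬Any)
open import Data.List.Relation.Unary.AllPairs using ([]; _∷_)
open import Data.List.Membership.Propositional using (_∈_)
open import Data.List.Relation.Unary.Unique.Propositional using (Unique)
open import Data.Product using (Σ; ∃; _×_; _,_)
open import Data.Sum using (inj₁; inj₂)
open import Data.Empty using (⊥; ⊥-elim)
open import Data.Unit using (⊤; tt)
open import Relation.Nullary using (¬_; Dec; yes; no)
open import Relation.Nullary.Decidable using (_×-dec_; _⊎-dec_)
open import Level using (0ℓ)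
open import Relation.Binary using (Rel; IsPartialEquivalence)
open import Relation.Binary.PropositionalEquality using (_≡_; refl; sym; trans; subst)

module _ {ℓ ℓ₁ ℓ₂} {A : Set ℓ} {_≈₁_ : Rel A ℓ₁} {_≈₂_ : Rel A ℓ₂}
         (per₁ : IsPartialEquivalence _≈₁_) (per₂ : IsPartialEquivalence _≈₂_) where
  private
    module P₁ = IsPartialEquivalence per₁
    module P₂ = IsPartialEquivalence per₂

  -- Covering is only assumed up to double negation: which relation holds is not decidable.
  covering-PERs⇒one-total : (∀ s t → ¬ s ≈₁ t → ¬ s ≈₂ t → ⊥) →
                            ∀ {a b x y} → ¬ a ≈₁ b → ¬ x ≈₂ y → ⊥
  covering-PERs⇒one-total cover {a} {b} {x} {y} a≉₁b x≉₂y =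
    related₁-to-x a λ a≈₁x → related₁-to-x b λ b≈₁x → a≉₁b (P₁.trans a≈₁x (P₁.sym b≈₁x))
    where
    related₁-to-x : ∀ s → ¬ ¬ s ≈₁ x
    related₁-to-x s s≉₁x = cover s x s≉₁x λ s≈₂x →
      cover s y (λ s≈₁y → cover x y (λ x≈₁y → s≉₁x (P₁.trans s≈₁y (P₁.sym x≈₁y))) x≉₂y)
                (λ s≈₂y → x≉₂y (P₂.trans (P₂.sym s≈₂x) s≈₂y))

module _ (G : Graph) where
  open Graph G renaming (sym to Adj-sym)

  SameEdge? : ∀ a b u w → Dec (SameEdge G a b u w)
  SameEdge? a b u w = ((a ≟ u) ×-dec (b ≟ w)) ⊎-dec ((a ≟ w) ×-dec (b ≟ u))

  SameEdge-swapʳ : ∀ {a b u w} → SameEdge G a b u w → SameEdge G a b w u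
  SameEdge-swapʳ (inj₁ (a≡u , b≡w)) = inj₂ (a≡u , b≡w)
  SameEdge-swapʳ (inj₂ (a≡w , b≡u)) = inj₁ (a≡w , b≡u)

  SameEdge-trans : ∀ {a b u w x y} → SameEdge G a b u w → SameEdge G u w x y → SameEdge G a b x y
  SameEdge-trans (inj₁ (refl , refl)) uw~xy = uw~xy
  SameEdge-trans (inj₂ (refl , refl)) (inj₁ (refl , refl)) = inj₂ (refl , refl)
  SameEdge-trans (inj₂ (refl , refl)) (inj₂ (refl , refl)) = inj₁ (refl , refl)

  SameEdge-sym : ∀ {a b u w} → SameEdge G a b u w → SameEdge G u w a b
  SameEdge-sym (inj₁ (refl , refl)) = inj₁ (refl , refl)
  SameEdge-sym (inj₂ (refl , refl)) = inj₂ (refl , refl)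

  infixr 5 _++ʷ_

  _++ʷ_ : ∀ {u v w} → Walk G u v → Walk G v w → Walk G u w
  []      ++ʷ q = q
  (e ∷ p) ++ʷ q = e ∷ (p ++ʷ q)

  reverseʷ : ∀ {u v} → Walk G u v → Walk G v u
  reverseʷ []      = []
  reverseʷ (e ∷ p) = reverseʷ p ++ʷ (Adj-sym e ∷ [])

  Avoids : Fin n → Fin n → ∀ {u v} → Walk G u v → Set
  Avoids a b []                  = ⊤
  Avoids a b (_∷_ {u} {w} _ p) = ¬ SameEdge G a b u w × Avoids a b p

  ++-avoids : ∀ {a b u v w} (p : Walk G u v) (q : Walk G v w) →
              Avoids a b p → Avoids a b q → Avoids a b (p ++ʷ q)
  ++-avoids []      q _              q-avoids = q-avoids
  ++-avoids (e ∷ p) q (≉e , p-avoids) q-avoids = ≉e , ++-avoids p q p-avoids q-avoids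

  reverse-avoids : ∀ {a b u v} (p : Walk G u v) → Avoids a b p → Avoids a b (reverseʷ p)
  reverse-avoids []      _              = tt
  reverse-avoids (e ∷ p) (≉e , p-avoids) =
    ++-avoids (reverseʷ p) _ (reverse-avoids p p-avoids) ((λ ≈e → ≉e (SameEdge-swapʳ ≈e)) , tt)

  ConnectedAvoiding : Fin n → Fin n → Rel (Fin n) 0ℓ
  ConnectedAvoiding a b s t = Σ (Walk G s t) (Avoids a b)

  ConnectedAvoiding-isPER : ∀ a b → IsPartialEquivalence (ConnectedAvoiding a b)
  ConnectedAvoiding-isPER a b = record
    { sym   = λ (p , p-avoids) → reverseʷ p , reverse-avoids p p-avoids
    ; trans = λ (p , p-avoids) (q , q-avoids) → p ++ʷ q , ++-avoids p q p-avoids q-avoids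
    }

  suffix-avoiding-path : ∀ {a b u w v} (p : Walk G w v) → u ∈ verts G p → IsPath G p → Avoids a b p →
                         Σ (Walk G u v) λ q → IsPath G q × Avoids a b q
  suffix-avoiding-path []      (here refl) p-path p-avoids = [] , p-path , p-avoids
  suffix-avoiding-path (e ∷ p) (here refl) p-path p-avoids = e ∷ p , p-path , p-avoids
  suffix-avoiding-path (e ∷ p) (there u∈p) (_ ∷ p-path) (_ , p-avoids) =
    suffix-avoiding-path p u∈p p-path p-avoids

  -- Cycles are cut off at the first repeated vertex, which keeps avoidance.
  avoiding-path : ∀ {a b u v} (p : Walk G u v) → Avoids a b p →
                  Σ (Walk G u v) λ q → IsPath G q × Avoids a b q
  avoiding-path []      _ = [] , [] ∷ [] , tt
  avoiding-path {u = u} (e ∷ p) (≉e , p-avoids) with avoiding-path p p-avoids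
  ... | q , q-path , q-avoids with any? (u ≟_) (verts G q)
  ... | yes u∈q = suffix-avoiding-path q u∈q q-path q-avoids
  ... | no  u∉q = e ∷ q , ¬Any⇒All¬ _ u∉q ∷ q-path , ≉e , q-avoids

  bridge⇒¬ConnectedAvoiding : ∀ {a b} → IsBridge G a b → ¬ ConnectedAvoiding a b a b
  bridge⇒¬ConnectedAvoiding {a} {b} (a~b , acyclic) (p , p-avoids)
    with avoiding-path p p-avoids
  ... | []          , _      , _          = irrefl a~b
  ... | _ ∷ []      , _      , (≉ab , _) = ≉ab (inj₁ (refl , refl))
  ... | e ∷ e′ ∷ q , q-path , _          =
    acyclic (Adj-sym a~b ∷ e ∷ e′ ∷ q) (s≤s (s≤s (s≤s z≤n)) , q-path) (inj₂ (here refl))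

  PathOfLength : Fin n → Fin n → ℕ → Set
  PathOfLength s t k = Σ (Walk G s t) λ p → IsPath G p × len G p ≡ k

  ¬shortestPath⇒¬PathOfLength : ∀ {s t} → ¬ ∃ (IsShortestPath G {s} {t}) → ∀ k → ¬ PathOfLength s t k
  ¬shortestPath⇒¬PathOfLength {s} {t} none = <-rec (λ k → ¬ PathOfLength s t k)
    λ { _ no-shorter (p , p-path , refl) →
          none (p , p-path , λ q q-path → ≮⇒≥ λ q<p → no-shorter q<p (q , q-path , refl)) }

  ¬¬shortestPath : Connected G → ∀ s t → ¬ ¬ ∃ (IsShortestPath G {s} {t})
  ¬¬shortestPath connected s t none with connected s t
  ... | p , p-path = ¬shortestPath⇒¬PathOfLength none (len G p) (p , p-path , refl)

  module _ {C : Set} (c : EdgeColouring G C) where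
    open EdgeColouring c

    SameEdge⇒same-colour : ∀ {x y u w} → SameEdge G x y u w → col u w ≡ col x y
    SameEdge⇒same-colour (inj₁ (refl , refl)) = refl
    SameEdge⇒same-colour (inj₂ (refl , refl)) = col-sym _ _

    ¬avoids⇒colour∈ : ∀ {x y s t} (p : Walk G s t) → ¬ Avoids x y p → col x y ∈ colours G c p
    ¬avoids⇒colour∈ [] ¬avoids = ⊥-elim (¬avoids tt)
    ¬avoids⇒colour∈ {x} {y} (_∷_ {u} {w} _ p) ¬avoids with SameEdge? x y u w
    ... | yes ≈e = here (sym (SameEdge⇒same-colour ≈e))
    ... | no  ≉e = there (¬avoids⇒colour∈ p λ p-avoids → ¬avoids (≉e , p-avoids))

    rainbow⇒colours-differ : ∀ {a b x y s t} (p : Walk G s t) → Unique (colours G c p) →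
                             ¬ Avoids a b p → ¬ Avoids x y p → ¬ SameEdge G a b x y →
                             ¬ col a b ≡ col x y
    rainbow⇒colours-differ [] _ ¬avoids-ab _ _ _ = ¬avoids-ab tt
    rainbow⇒colours-differ {a} {b} {x} {y} (_∷_ {u} {w} _ p) (fresh ∷ p-rainbow)
                           ¬avoids-ab ¬avoids-xy ab≉xy ab≡xy
      with SameEdge? a b u w | SameEdge? x y u w
    ... | yes ab≈uw | _ =
      All¬⇒¬Any fresh (subst (_∈ colours G c p) (sym (trans (SameEdge⇒same-colour ab≈uw) ab≡xy))
        (¬avoids⇒colour∈ p λ p-avoids →
          ¬avoids-xy ((λ xy≈uw → ab≉xy (SameEdge-trans ab≈uw (SameEdge-sym xy≈uw))) , p-avoids)))
    ... | no _ | yes xy≈uw =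
      All¬⇒¬Any fresh (subst (_∈ colours G c p) (sym (trans (SameEdge⇒same-colour xy≈uw) (sym ab≡xy)))
        (¬avoids⇒colour∈ p λ p-avoids →
          ¬avoids-ab ((λ ab≈uw → ab≉xy (SameEdge-trans ab≈uw (SameEdge-sym xy≈uw))) , p-avoids)))
    ... | no ab≉uw | no xy≉uw =
      rainbow⇒colours-differ p p-rainbow (λ p-avoids → ¬avoids-ab (ab≉uw , p-avoids))
                             (λ p-avoids → ¬avoids-xy (xy≉uw , p-avoids)) ab≉xy ab≡xy

    same-colour⇒ConnectedAvoiding-cover : Connected G → IsVSRC G c →
      ∀ {a b x y} → ¬ SameEdge G a b x y → col a b ≡ col x y →
      ∀ s t → ¬ ConnectedAvoiding a b s t → ¬ ConnectedAvoiding x y s t → ⊥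
    same-colour⇒ConnectedAvoiding-cover connected rainbow ab≉xy ab≡xy s t ¬st-ab ¬st-xy =
      ¬¬shortestPath connected s t λ (p , p-shortest) →
        rainbow⇒colours-differ p (rainbow p p-shortest)
          (λ p-avoids → ¬st-ab (p , p-avoids)) (λ p-avoids → ¬st-xy (p , p-avoids)) ab≉xy ab≡xy

lemma9 : (G : Graph) → Connected G → IsCactus G →
         {C : Set} (c : EdgeColouring G C) → IsVSRC G c →
         ∀ a b x y → IsBridge G a b → IsBridge G x y →
         ¬ SameEdge G a b x y →
         ¬ (EdgeColouring.col c a b ≡ EdgeColouring.col c x y)
lemma9 G connected _ c rainbow a b x y ab-bridge xy-bridge ab≉xy ab≡xy =
  covering-PERs⇒one-total (ConnectedAvoiding-isPER G a b) (ConnectedAvoiding-isPER G x y)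
    (same-colour⇒ConnectedAvoiding-cover G c connected rainbow ab≉xy ab≡xy)
    (bridge⇒¬ConnectedAvoiding G ab-bridge) (bridge⇒¬ConnectedAvoiding G xy-bridge)
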